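{- Let $k$ be the finite field with $q$ elements and $l\ge1$. The set $$\mathcal M^l=\mathcal A^l\cup\{\alpha_1\cdots\alpha_l\in\mathcal C^l : \alpha_1\cdots\alpha_{l-1}\in\mathcal A^{l-1}\text{ and }\alpha_2\cdots\alpha_l\in\mathcal A^{l-1}\}$$ is a mock parity check set of length $l$ in $k^l$ (with alphabet $E=k$).
   Context: For a field $k$, let $F_k$ be the free monoid of finite words with letters in $k$, $F_k^l=k^l$ the words of length $l$. For $\alpha\in k$ put $M_\alpha=\begin{pmatrix}0&-1\\1&\alpha\end{pmatrix}$ and $\pi(\alpha_1\cdots\alpha_l)=M_{\alpha_1}\cdots M_{\alpha_l}\in\mathrm{SL}_2(k)$ (identity for the empty word). Let $\mathcal A$ be the set of words $w$ with $\pi(w)$ having lower-right entry $0$ (equivalently $\pi(w)=\begin{pmatrix}a&-b\\ b^{ -1}&0\end{pmatrix}$, $a\in k$, $b\in k^*$), $\mathcal C=F_k\setminus\mathcal A$, $\mathcal A^l=\mathcal A\cap F_k^l$, $\mathcal C^l=\mathcal C\cap F_k^l$. For a finite set $E$ with $N\ge2$ elements and words $w=\alpha_0\cdots\alpha_{d-1}$, $w'=\alpha_1\cdots\alpha_d$ in $E^d$, $w'$ is an immediate successor of $w$ and $w$ an immediate predecessor of $w'$. A mock parity check set of length $d$ is a subset $\mathcal M\subset E^d$ such that each element of $\mathcal M$ has a unique immediate successor and a unique immediate predecessor in $\mathcal M$, and $\#\mathcal M=N^{d-1}$. -}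

module Defs where

open import Level using (0ℓ)
open import Data.Nat using (ℕ; zero; suc; _^_)
open import Data.Fin using (Fin)
open import Data.List using (List; []; _∷_; map; concatMap; filter; length; allFin)
open import Data.Vec using (Vec; []; _∷_; tail)
open import Data.Product using (Σ; ∃; _×_; _,_)
open import Data.Sum using (_⊎_)
open import Function.Bundles using (_↔_; Inverse)
open import Relation.Nullary using (¬_; Dec; yes; no)
open import Relation.Nullary.Decidable using (_⊎-dec_; _×-dec_; ¬?)
open import Relation.Unary using (Pred; Decidable)
open import Relation.Binary.PropositionalEquality using (_≡_; _≢_)
open import Relation.Binary.Definitions using (DecidableEquality)
open import Algebra.Structures using (IsCommutativeRing)

record FiniteField : Set₁ where
  field
    K     : Set
    _+_   : K → K → K
    _*_   : K → K → K
    -_    : K → K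
    0#    : K
    1#    : K
    isCommutativeRing : IsCommutativeRing _≡_ _+_ _*_ -_ 0# 1#
    0≢1   : 0# ≢ 1#
    inverse : ∀ x → x ≢ 0# → ∃ λ y → x * y ≡ 1#
    _≟_   : DecidableEquality K
    q     : ℕ
    enum  : Fin q ↔ K

allWords : {E : Set} {N : ℕ} → Fin N ↔ E → (d : ℕ) → List (Vec E d)
allWords e zero = [] ∷ []
allWords {N = N} e (suc d) =
  concatMap (λ a → map (a ∷_) (allWords e d)) (map (Inverse.to e) (allFin N))

initV : {E : Set} {d : ℕ} → Vec E (suc d) → Vec E d
initV (x ∷ []) = []
initV (x ∷ y ∷ xs) = x ∷ initV (y ∷ xs)

ImmSucc : {E : Set} {d : ℕ} → Vec E (suc d) → Vec E (suc d) → Set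
ImmSucc w w' = tail w ≡ initV w'

card : {E : Set} {N : ℕ} → Fin N ↔ E → (d : ℕ) →
       {M : Pred (Vec E d) 0ℓ} → Decidable M → ℕ
card e d M? = length (filter M? (allWords e d))

-- mock parity check set of length d = suc n, with #E = N
record MockParityCheckSet {E : Set} {N : ℕ} (e : Fin N ↔ E) (n : ℕ)
         (M : Pred (Vec E (suc n)) 0ℓ) (M? : Decidable M) : Set where
  field
    uniqueSucc : ∀ w → M w → Σ (Vec E (suc n)) λ w' →
      (M w' × ImmSucc w w') × (∀ w'' → M w'' → ImmSucc w w'' → w'' ≡ w')
    uniquePred : ∀ w → M w → Σ (Vec E (suc n)) λ w' →
      (M w' × ImmSucc w' w) × (∀ w'' → M w'' → ImmSucc w'' w → w'' ≡ w')
    cardinality : card e (suc n) M? ≡ N ^ n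

module _ (F : FiniteField) where
  open FiniteField F

  record Mat2 : Set where
    constructor mat
    field a b c d : K

  _·_ : Mat2 → Mat2 → Mat2
  mat a b c d · mat a' b' c' d' =
    mat ((a * a') + (b * c')) ((a * b') + (b * d'))
        ((c * a') + (d * c')) ((c * b') + (d * d'))

  Mα : K → Mat2
  Mα α = mat 0# (- 1#) 1# α

  π : {l : ℕ} → Vec K l → Mat2
  π [] = mat 1# 0# 0# 1#
  π (α ∷ w) = Mα α · π w

  𝒜 : {l : ℕ} → Pred (Vec K l) 0ℓ
  𝒜 w = Mat2.d (π w) ≡ 0#

  𝒜? : {l : ℕ} → Decidable (𝒜 {l})
  𝒜? w = Mat2.d (π w) ≟ 0#

  𝒞 : {l : ℕ} → Pred (Vec K l) 0ℓ
  𝒞 w = ¬ 𝒜 w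

  -- ℳ^l for l = suc n
  ℳ : (n : ℕ) → Pred (Vec K (suc n)) 0ℓ
  ℳ n w = 𝒜 w ⊎ (𝒞 w × 𝒜 (initV w) × 𝒜 (tail w))

  ℳ? : (n : ℕ) → Decidable (ℳ n)
  ℳ? n w = 𝒜? w ⊎-dec (¬? (𝒜? w) ×-dec (𝒜? (initV w) ×-dec 𝒜? (tail w)))

{-# OPTIONS --safe #-}
module Submission where

-- π(w) lies in SL₂(k), so for w ∈ 𝒜 (lower-right entry d = 0) the entries b, c satisfy b c = -1 and are
-- nonzero. The lower-right entry of π(αw) is b + α d and that of π(wβ) is β d - c. Hence 𝒜 never
-- contains both w and αw, nor both w and wβ, while for w ∉ 𝒜 exactly one letter α puts αw in 𝒜 and
-- exactly one letter β puts wβ in 𝒜. So for every word v of length l - 1 exactly one letter α has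
-- αv ∈ ℳ: the one with αv ∈ 𝒜 if v ∉ 𝒜, and the one with α·init(v) ∈ 𝒜 if v ∈ 𝒜 (then init(v) ∉ 𝒜);
-- symmetrically on the right. This gives unique successors and predecessors, and counting ℳ by
-- the last l - 1 letters gives #ℳ = q^(l-1).

open import Level using (0ℓ)
open import Data.Nat using (ℕ; zero; suc; _^_)
open import Data.Nat.ListAction using (sum)
open import Data.Fin using (Fin; zero; suc)
open import Data.Fin.Properties using (0≢1+n; suc-injective)
open import Data.Bool using (true; false; if_then_else_)
open import Data.List using (List; []; _∷_; _++_; map; concatMap; filter; length; tabulate; allFin)
open import Data.List.Properties
  using ( filter-++; filter-none; filter-accept; filter-reject
        ; length-++; length-map; length-tabulate; map-cong; map-∘; map-tabulate )
import Data.List.Relation.Unary.All.Properties as All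
open import Data.Vec using (Vec; []; _∷_; tail; _∷ʳ_; initLast)
open import Data.Product using (Σ; ∃; ∃!; _×_; _,_)
open import Data.Sum using (inj₁; inj₂)
open import Data.Empty using (⊥-elim)
open import Function using (_∘_; id; const)
open import Function.Bundles using (_↔_; _⇔_; mk⇔; Inverse; Equivalence)
open import Relation.Nullary using (¬_; Dec; does; yes; no)
open import Relation.Unary using (Pred; Decidable)
open import Relation.Binary.PropositionalEquality
open import Algebra.Bundles using (CommutativeRing)
import Algebra.Properties.CommutativeSemigroup as CommutativeSemigroupProperties

open import Defs

∃!-⇔ : {A : Set} {P Q : A → Set} → (∀ x → P x ⇔ Q x) → ∃! _≡_ P → ∃! _≡_ Q
∃!-⇔ P⇔Q (x , Px , unique) =
  x , Equivalence.to (P⇔Q x) Px , λ {y} Qy → unique (Equivalence.from (P⇔Q y) Qy)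

module Counting where
  open import Data.Nat using (_+_; _*_)
  open import Data.Nat.Properties using (*-identityʳ; *-zeroʳ; +-commutativeSemigroup)
  open CommutativeSemigroupProperties +-commutativeSemigroup using (interchange)

  count : {A : Set} {P : Pred A 0ℓ} → Decidable P → List A → ℕ
  count P? = length ∘ filter P?

  indicator : {P : Set} → Dec P → ℕ
  indicator P? = if does P? then 1 else 0

  sum-map-const : {A : Set} (k : ℕ) (xs : List A) → sum (map (const k) xs) ≡ length xs * k
  sum-map-const k []       = refl
  sum-map-const k (x ∷ xs) = cong (k +_) (sum-map-const k xs)

  sum-map-+ : {A : Set} (f g : A → ℕ) (xs : List A) →
              sum (map (λ x → f x + g x) xs) ≡ sum (map f xs) + sum (map g xs)
  sum-map-+ f g []       = refl
  sum-map-+ f g (x ∷ xs) = trans (cong (f x + g x +_) (sum-map-+ f g xs)) (interchange (f x) (g x) _ _)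

  module _ {A : Set} {P : Pred A 0ℓ} (P? : Decidable P) where

    count-∷ : ∀ x xs → count P? (x ∷ xs) ≡ indicator (P? x) + count P? xs
    count-∷ x xs with does (P? x)
    ... | true  = refl
    ... | false = refl

    count≡sum-indicator : ∀ xs → count P? xs ≡ sum (map (indicator ∘ P?) xs)
    count≡sum-indicator []       = refl
    count≡sum-indicator (x ∷ xs) =
      trans (count-∷ x xs) (cong (indicator (P? x) +_) (count≡sum-indicator xs))

    count-++ : ∀ xs ys → count P? (xs ++ ys) ≡ count P? xs + count P? ys
    count-++ xs ys = trans (cong length (filter-++ P? xs ys)) (length-++ (filter P? xs))

    count-tabulate-none : ∀ {m} (f : Fin m → A) → (∀ i → ¬ P (f i)) → count P? (tabulate f) ≡ 0
    count-tabulate-none f none = cong length (filter-none P? (All.tabulate⁺ none))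

    count-tabulate-∃! : ∀ {m} (f : Fin m → A) → ∃! _≡_ (P ∘ f) → count P? (tabulate f) ≡ 1
    count-tabulate-∃! f (zero , Pf₀ , unique) =
      trans (cong length (filter-accept P? Pf₀))
            (cong suc (count-tabulate-none (f ∘ suc) (λ i → 0≢1+n ∘ unique)))
    count-tabulate-∃! f (suc i , Pfi , unique) =
      trans (cong length (filter-reject P? (0≢1+n ∘ sym ∘ unique)))
            (count-tabulate-∃! (f ∘ suc) (i , Pfi , suc-injective ∘ unique))

  module _ {A B C : Set} (g : A → B → C) (ys : List B) where

    length-concatMap-map : ∀ xs → length (concatMap (λ x → map (g x) ys) xs) ≡ length xs * length ys
    length-concatMap-map []       = refl
    length-concatMap-map (x ∷ xs) = trans (length-++ (map (g x) ys))
                                          (cong₂ _+_ (length-map (g x) ys) (length-concatMap-map xs))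

    count-concatMap-map : {P : Pred C 0ℓ} (P? : Decidable P) → ∀ xs →
      count P? (concatMap (λ x → map (g x) ys) xs) ≡ sum (map (λ y → count (λ x → P? (g x y)) xs) ys)
    count-concatMap-map P? []       = sym (trans (sum-map-const 0 ys) (*-zeroʳ (length ys)))
    count-concatMap-map P? (x ∷ xs) = begin
      count P? (map (g x) ys ++ concatMap (λ x → map (g x) ys) xs)
        ≡⟨ count-++ P? (map (g x) ys) _ ⟩
      count P? (map (g x) ys) + count P? (concatMap (λ x → map (g x) ys) xs)
        ≡⟨ cong₂ _+_ (trans (count≡sum-indicator P? (map (g x) ys)) (cong sum (sym (map-∘ ys))))
                     (count-concatMap-map P? xs) ⟩
      sum (map (λ y → indicator (P? (g x y))) ys) + sum (map (λ y → count (λ x → P? (g x y)) xs) ys)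
        ≡⟨ sum-map-+ _ _ ys ⟨
      sum (map (λ y → indicator (P? (g x y)) + count (λ x → P? (g x y)) xs) ys)
        ≡⟨ cong sum (map-cong (λ y → count-∷ (λ x → P? (g x y)) x xs) ys) ⟨
      sum (map (λ y → count (λ x → P? (g x y)) (x ∷ xs)) ys) ∎
      where open ≡-Reasoning

  module _ {E : Set} {N : ℕ} (e : Fin N ↔ E) where
    open Inverse e

    letters : List E
    letters = map to (allFin N)

    length-letters : length letters ≡ N
    length-letters = trans (length-map to (allFin N)) (length-tabulate _)

    count-letters-∃! : {P : Pred E 0ℓ} (P? : Decidable P) → ∃! _≡_ P → count P? letters ≡ 1
    count-letters-∃! {P} P? (x , Px , unique) =
      trans (cong (count P?) (map-tabulate {n = N} id to))
            (count-tabulate-∃! P? to (from x , subst P (sym (strictlyInverseˡ x)) Px ,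
                                       λ {j} P[to-j] → trans (cong from (unique P[to-j])) (strictlyInverseʳ j)))

    length-allWords : ∀ d → length (allWords e d) ≡ N ^ d
    length-allWords zero    = refl
    length-allWords (suc d) =
      trans (length-concatMap-map _∷_ (allWords e d) letters)
            (cong₂ _*_ length-letters (length-allWords d))

    card-∃!-head : ∀ n {P : Pred (Vec E (suc n)) 0ℓ} (P? : Decidable P) →
                   (∀ v → ∃! _≡_ (λ x → P (x ∷ v))) → card e (suc n) P? ≡ N ^ n
    card-∃!-head n P? unique-head = begin
      count P? (concatMap (λ x → map (x ∷_) (allWords e n)) letters)
        ≡⟨ count-concatMap-map _∷_ (allWords e n) P? letters ⟩
      sum (map (λ v → count (λ x → P? (x ∷ v)) letters) (allWords e n))
        ≡⟨ cong sum (map-cong (λ v → count-letters-∃! (λ x → P? (x ∷ v)) (unique-head v)) (allWords e n)) ⟩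
      sum (map (const 1) (allWords e n))
        ≡⟨ sum-map-const 1 (allWords e n) ⟩
      length (allWords e n) * 1
        ≡⟨ *-identityʳ _ ⟩
      length (allWords e n)
        ≡⟨ length-allWords n ⟩
      N ^ n ∎
      where open ≡-Reasoning

open Counting

module _ {E : Set} where

  initV-∷ʳ : ∀ {n} (u : Vec E n) x → initV (u ∷ʳ x) ≡ u
  initV-∷ʳ []          x = refl
  initV-∷ʳ (y ∷ [])    x = refl
  initV-∷ʳ (y ∷ z ∷ u) x = cong (y ∷_) (initV-∷ʳ (z ∷ u) x)

  ∷ʳ-initV : ∀ {n} (w : Vec E (suc n)) → ∃ λ x → initV w ∷ʳ x ≡ w
  ∷ʳ-initV w with initLast w
  ... | u , x , refl = x , cong (_∷ʳ x) (initV-∷ʳ u x)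

  module _ {n} {M : Pred (Vec E (suc n)) 0ℓ} where

    unique-successor : (∀ u → ∃! _≡_ (λ x → M (u ∷ʳ x))) → ∀ w →
      Σ (Vec E (suc n)) λ w′ → (M w′ × ImmSucc w w′) × (∀ w″ → M w″ → ImmSucc w w″ → w″ ≡ w′)
    unique-successor unique-last w with unique-last (tail w)
    ... | x , Mx , unique = tail w ∷ʳ x , (Mx , sym (initV-∷ʳ (tail w) x)) , only
      where
      only : ∀ w″ → M w″ → tail w ≡ initV w″ → w″ ≡ tail w ∷ʳ x
      only w″ Mw″ tail≡init with ∷ʳ-initV w″
      ... | y , init∷ʳy≡w″ = trans w″≡ (cong (tail w ∷ʳ_) (sym (unique (subst M w″≡ Mw″))))
        where
        w″≡ : w″ ≡ tail w ∷ʳ y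
        w″≡ = trans (sym init∷ʳy≡w″) (cong (_∷ʳ y) (sym tail≡init))

    unique-predecessor : (∀ v → ∃! _≡_ (λ x → M (x ∷ v))) → ∀ w →
      Σ (Vec E (suc n)) λ w′ → (M w′ × ImmSucc w′ w) × (∀ w″ → M w″ → ImmSucc w″ w → w″ ≡ w′)
    unique-predecessor unique-head w with unique-head (initV w)
    ... | x , Mx , unique = x ∷ initV w , (Mx , refl) , only
      where
      only : ∀ w″ → M w″ → tail w″ ≡ initV w → w″ ≡ x ∷ initV w
      only (y ∷ v) My∷v refl = cong (_∷ v) (sym (unique My∷v))

module _ (F : FiniteField) where
  open FiniteField F using (K; isCommutativeRing; 0≢1; inverse)

  commutativeRing : CommutativeRing 0ℓ 0ℓ
  commutativeRing = record { isCommutativeRing = isCommutativeRing }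

  open CommutativeRing commutativeRing
    using ( _+_; _*_; -_; _-_; 0#; 1#; +-comm; +-identityˡ; +-identityʳ; -‿inverseˡ; -‿inverseʳ
          ; *-assoc; *-comm; *-identityˡ; *-identityʳ; zeroˡ; zeroʳ; distribˡ; distribʳ
          ; ring; +-commutativeSemigroup; *-commutativeSemigroup )
  open import Algebra.Properties.Ring ring
    using (-‿involutive; -0#≈0#; -‿distribˡ-*; -‿distribʳ-*; -‿+-comm; -1*x≈-x; +-cancelˡ; -‿injective)
  open CommutativeSemigroupProperties +-commutativeSemigroup using (interchange)
  open CommutativeSemigroupProperties *-commutativeSemigroup using (x∙yz≈z∙yx)
  open ≡-Reasoning

  x+y*z≡x : ∀ x y {z} → z ≡ 0# → x + y * z ≡ x
  x+y*z≡x x y refl = trans (cong (x +_) (zeroʳ y)) (+-identityʳ x)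

  *-cancelʳ-invertible : ∀ {x y α β} → y * x ≡ 1# → α * y ≡ β * y → α ≡ β
  *-cancelʳ-invertible {x} {y} {α} {β} yx≡1 αy≡βy = begin
    α             ≡⟨ *-identityʳ α ⟨
    α * 1#        ≡⟨ cong (α *_) yx≡1 ⟨
    α * (y * x)   ≡⟨ *-assoc α y x ⟨
    α * y * x     ≡⟨ cong (_* x) αy≡βy ⟩
    β * y * x     ≡⟨ *-assoc β y x ⟩
    β * (y * x)   ≡⟨ cong (β *_) yx≡1 ⟩
    β * 1#        ≡⟨ *-identityʳ β ⟩
    β             ∎

  ∃!-linear : ∀ {x y} → y ≢ 0# → ∃! _≡_ (λ α → x + α * y ≡ 0#)
  ∃!-linear {x} {y} y≢0 with inverse y y≢0
  ... | y⁻¹ , yy⁻¹≡1 = - x * y⁻¹ , solves , λ x+αy≡0 →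
    *-cancelʳ-invertible yy⁻¹≡1 (+-cancelˡ x _ _ (trans solves (sym x+αy≡0)))
    where
    solves : x + - x * y⁻¹ * y ≡ 0#
    solves = begin
      x + - x * y⁻¹ * y     ≡⟨ cong (x +_) (*-assoc (- x) y⁻¹ y) ⟩
      x + - x * (y⁻¹ * y)   ≡⟨ cong (λ t → x + - x * t) (trans (*-comm y⁻¹ y) yy⁻¹≡1) ⟩
      x + - x * 1#          ≡⟨ cong (x +_) (*-identityʳ (- x)) ⟩
      x - x                 ≡⟨ -‿inverseʳ x ⟩
      0#                    ∎

  infixl 7 _⋆_
  _⋆_ : Mat2 F → Mat2 F → Mat2 F
  _⋆_ = _·_ F

  I : Mat2 F
  I = mat 1# 0# 0# 1#

  det : Mat2 F → K
  det (mat a b c d) = a * d - b * c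

  mat-cong : ∀ {a b c d a′ b′ c′ d′} → a ≡ a′ → b ≡ b′ → c ≡ c′ → d ≡ d′ → mat {F} a b c d ≡ mat a′ b′ c′ d′
  mat-cong refl refl refl refl = refl

  ⋆-identityˡ : ∀ m → I ⋆ m ≡ m
  ⋆-identityˡ (mat a b c d) = mat-cong (1x+0y≡x a c) (1x+0y≡x b d) (0x+1y≡y a c) (0x+1y≡y b d)
    where
    1x+0y≡x : ∀ x y → 1# * x + 0# * y ≡ x
    1x+0y≡x x y = trans (cong₂ _+_ (*-identityˡ x) (zeroˡ y)) (+-identityʳ x)
    0x+1y≡y : ∀ x y → 0# * x + 1# * y ≡ y
    0x+1y≡y x y = trans (cong₂ _+_ (zeroˡ x) (*-identityˡ y)) (+-identityˡ y)

  ⋆-identityʳ : ∀ m → m ⋆ I ≡ m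
  ⋆-identityʳ (mat a b c d) = mat-cong (x1+y0≡x a b) (x0+y1≡y a b) (x1+y0≡x c d) (x0+y1≡y c d)
    where
    x1+y0≡x : ∀ x y → x * 1# + y * 0# ≡ x
    x1+y0≡x x y = trans (cong₂ _+_ (*-identityʳ x) (zeroʳ y)) (+-identityʳ x)
    x0+y1≡y : ∀ x y → x * 0# + y * 1# ≡ y
    x0+y1≡y x y = trans (cong₂ _+_ (zeroʳ x) (*-identityʳ y)) (+-identityˡ y)

  row-column-assoc : ∀ p q a b c d r s →
    (p * a + q * c) * r + (p * b + q * d) * s ≡ p * (a * r + b * s) + q * (c * r + d * s)
  row-column-assoc p q a b c d r s = begin
    (p * a + q * c) * r + (p * b + q * d) * s
      ≡⟨ cong₂ _+_ (distribʳ r (p * a) (q * c)) (distribʳ s (p * b) (q * d)) ⟩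
    (p * a * r + q * c * r) + (p * b * s + q * d * s)
      ≡⟨ interchange _ _ _ _ ⟩
    (p * a * r + p * b * s) + (q * c * r + q * d * s)
      ≡⟨ cong₂ _+_ (cong₂ _+_ (*-assoc p a r) (*-assoc p b s)) (cong₂ _+_ (*-assoc q c r) (*-assoc q d s)) ⟩
    (p * (a * r) + p * (b * s)) + (q * (c * r) + q * (d * s))
      ≡⟨ cong₂ _+_ (distribˡ p (a * r) (b * s)) (distribˡ q (c * r) (d * s)) ⟨
    p * (a * r + b * s) + q * (c * r + d * s) ∎

  ⋆-assoc : ∀ m m′ m″ → (m ⋆ m′) ⋆ m″ ≡ m ⋆ (m′ ⋆ m″)
  ⋆-assoc (mat a b c d) (mat a′ b′ c′ d′) (mat a″ b″ c″ d″) =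
    mat-cong (row-column-assoc a b a′ b′ c′ d′ a″ c″) (row-column-assoc a b a′ b′ c′ d′ b″ d″)
             (row-column-assoc c d a′ b′ c′ d′ a″ c″) (row-column-assoc c d a′ b′ c′ d′ b″ d″)

  Mα-⋆ : ∀ α a b c d → Mα F α ⋆ mat a b c d ≡ mat (- c) (- d) (a + α * c) (b + α * d)
  Mα-⋆ α a b c d = mat-cong (0x-y≡-y a c) (0x-y≡-y b d)
                            (cong (_+ α * c) (*-identityˡ a)) (cong (_+ α * d) (*-identityˡ b))
    where
    0x-y≡-y : ∀ x y → 0# * x + - 1# * y ≡ - y
    0x-y≡-y x y = trans (cong₂ _+_ (zeroˡ x) (-1*x≈-x y)) (+-identityˡ (- y))

  det-I : det I ≡ 1#
  det-I = trans (cong₂ _-_ (*-identityˡ 1#) (zeroˡ 0#)) (trans (cong (1# +_) -0#≈0#) (+-identityʳ 1#))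

  det-Mα-⋆ : ∀ α m → det (Mα F α ⋆ m) ≡ det m
  det-Mα-⋆ α (mat a b c d) = begin
    det (Mα F α ⋆ mat a b c d)
      ≡⟨ cong det (Mα-⋆ α a b c d) ⟩
    - c * (b + α * d) - - d * (a + α * c)
      ≡⟨ cong₂ _-_ (-‿distribˡ-* c _) (-‿distribˡ-* d _) ⟨
    - (c * (b + α * d)) - - (d * (a + α * c))
      ≡⟨ cong₂ _+_ (cong -_ (distribˡ c b (α * d))) (trans (-‿involutive _) (distribˡ d a (α * c))) ⟩
    - (c * b + c * (α * d)) + (d * a + d * (α * c))
      ≡⟨ cong (_+ (d * a + d * (α * c))) (-‿+-comm (c * b) (c * (α * d))) ⟨
    (- (c * b) + - (c * (α * d))) + (d * a + d * (α * c))
      ≡⟨ interchange _ _ _ _ ⟩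
    (- (c * b) + d * a) + (- (c * (α * d)) + d * (α * c))
      ≡⟨ cong₂ _+_ (+-comm _ _) (trans (cong (λ t → - t + d * (α * c)) (x∙yz≈z∙yx c α d)) (-‿inverseˡ _)) ⟩
    (d * a - c * b) + 0#
      ≡⟨ +-identityʳ _ ⟩
    d * a - c * b
      ≡⟨ cong₂ _-_ (*-comm d a) (*-comm c b) ⟩
    a * d - b * c ∎

  det-π : ∀ {l} (w : Vec K l) → det (π F w) ≡ 1#
  det-π []      = det-I
  det-π (α ∷ w) = trans (det-Mα-⋆ α (π F w)) (det-π w)

  π-∷ʳ : ∀ {l} (u : Vec K l) β → π F (u ∷ʳ β) ≡ π F u ⋆ Mα F β
  π-∷ʳ []      β = trans (⋆-identityʳ (Mα F β)) (sym (⋆-identityˡ (Mα F β)))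
  π-∷ʳ (α ∷ u) β = trans (cong (Mα F α ⋆_) (π-∷ʳ u β)) (sym (⋆-assoc (Mα F α) (π F u) (Mα F β)))

  a[_] b[_] c[_] d[_] : ∀ {l} → Vec K l → K
  a[ w ] = Mat2.a (π F w)
  b[ w ] = Mat2.b (π F w)
  c[ w ] = Mat2.c (π F w)
  d[ w ] = Mat2.d (π F w)

  d-∷ : ∀ {l} α (w : Vec K l) → d[ α ∷ w ] ≡ b[ w ] + α * d[ w ]
  d-∷ α w = cong (_+ α * d[ w ]) (*-identityˡ b[ w ])

  d-∷ʳ : ∀ {l} (u : Vec K l) β → d[ u ∷ʳ β ] ≡ - c[ u ] + β * d[ u ]
  d-∷ʳ u β = trans (cong Mat2.d (π-∷ʳ u β)) (cong₂ _+_ c*-1≡-c (*-comm d[ u ] β))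
    where
    c*-1≡-c : c[ u ] * - 1# ≡ - c[ u ]
    c*-1≡-c = trans (sym (-‿distribʳ-* c[ u ] 1#)) (cong -_ (*-identityʳ c[ u ]))

  𝒜⇒b*c≢0 : ∀ {l} (w : Vec K l) → 𝒜 F w → b[ w ] * c[ w ] ≢ 0#
  𝒜⇒b*c≢0 w d≡0 bc≡0 = 0≢1 (begin
    0#                            ≡⟨ -0#≈0# ⟨
    - 0#                          ≡⟨ cong -_ bc≡0 ⟨
    - (b[ w ] * c[ w ])           ≡⟨ +-identityˡ _ ⟨
    0# - b[ w ] * c[ w ]          ≡⟨ cong (_- b[ w ] * c[ w ]) (trans (cong (a[ w ] *_) d≡0) (zeroʳ a[ w ])) ⟨
    a[ w ] * d[ w ] - b[ w ] * c[ w ] ≡⟨ det-π w ⟩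
    1#                            ∎)

  𝒜⇒b≢0 : ∀ {l} (w : Vec K l) → 𝒜 F w → b[ w ] ≢ 0#
  𝒜⇒b≢0 w w∈𝒜 b≡0 = 𝒜⇒b*c≢0 w w∈𝒜 (trans (cong (_* c[ w ]) b≡0) (zeroˡ c[ w ]))

  𝒜⇒c≢0 : ∀ {l} (w : Vec K l) → 𝒜 F w → c[ w ] ≢ 0#
  𝒜⇒c≢0 w w∈𝒜 c≡0 = 𝒜⇒b*c≢0 w w∈𝒜 (trans (cong (b[ w ] *_) c≡0) (zeroʳ b[ w ]))

  []∉𝒜 : ¬ 𝒜 F []
  []∉𝒜 = 0≢1 ∘ sym

  𝒜⇒∷∉𝒜 : ∀ {l} (w : Vec K l) {α} → 𝒜 F w → ¬ 𝒜 F (α ∷ w)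
  𝒜⇒∷∉𝒜 w {α} w∈𝒜 α∷w∈𝒜 = 𝒜⇒b≢0 w w∈𝒜 (begin
    b[ w ]                ≡⟨ x+y*z≡x b[ w ] α w∈𝒜 ⟨
    b[ w ] + α * d[ w ]   ≡⟨ d-∷ α w ⟨
    d[ α ∷ w ]            ≡⟨ α∷w∈𝒜 ⟩
    0#                    ∎)

  𝒜⇒∷ʳ∉𝒜 : ∀ {l} (u : Vec K l) {β} → 𝒜 F u → ¬ 𝒜 F (u ∷ʳ β)
  𝒜⇒∷ʳ∉𝒜 u {β} u∈𝒜 u∷ʳβ∈𝒜 = 𝒜⇒c≢0 u u∈𝒜 (-‿injective (begin
    - c[ u ]                ≡⟨ x+y*z≡x (- c[ u ]) β u∈𝒜 ⟨
    - c[ u ] + β * d[ u ]   ≡⟨ d-∷ʳ u β ⟨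
    d[ u ∷ʳ β ]             ≡⟨ u∷ʳβ∈𝒜 ⟩
    0#                      ≡⟨ -0#≈0# ⟨
    - 0#                    ∎))

  𝒜⇒initV∉𝒜 : ∀ {n} (w : Vec K (suc n)) → 𝒜 F w → ¬ 𝒜 F (initV w)
  𝒜⇒initV∉𝒜 w w∈𝒜 initV∈𝒜 with ∷ʳ-initV w
  ... | _ , initV∷ʳβ≡w = 𝒜⇒∷ʳ∉𝒜 (initV w) initV∈𝒜 (subst (𝒜 F) (sym initV∷ʳβ≡w) w∈𝒜)

  ∃!-𝒜-∷ : ∀ {l} (w : Vec K l) → ¬ 𝒜 F w → ∃! _≡_ (λ α → 𝒜 F (α ∷ w))
  ∃!-𝒜-∷ w w∉𝒜 =
    ∃!-⇔ (λ α → mk⇔ (trans (d-∷ α w)) (trans (sym (d-∷ α w)))) (∃!-linear w∉𝒜)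

  ∃!-𝒜-∷ʳ : ∀ {l} (u : Vec K l) → ¬ 𝒜 F u → ∃! _≡_ (λ β → 𝒜 F (u ∷ʳ β))
  ∃!-𝒜-∷ʳ u u∉𝒜 =
    ∃!-⇔ (λ β → mk⇔ (trans (d-∷ʳ u β)) (trans (sym (d-∷ʳ u β)))) (∃!-linear u∉𝒜)

  ∃!-ℳ-∷ : ∀ n (v : Vec K n) → ∃! _≡_ (λ α → ℳ F n (α ∷ v))
  ∃!-ℳ-∷ n v with 𝒜? F v
  ... | no v∉𝒜 = ∃!-⇔ (λ α → mk⇔ inj₁ λ where
                                  (inj₁ α∷v∈𝒜)          → α∷v∈𝒜
                                  (inj₂ (_ , _ , v∈𝒜)) → ⊥-elim (v∉𝒜 v∈𝒜))
                      (∃!-𝒜-∷ v v∉𝒜)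
  ∃!-ℳ-∷ zero    []      | yes []∈𝒜 = ⊥-elim ([]∉𝒜 []∈𝒜)
  ∃!-ℳ-∷ (suc n) (y ∷ t) | yes v∈𝒜  =
    ∃!-⇔ (λ α → mk⇔ (λ init∈𝒜 → inj₂ (𝒜⇒∷∉𝒜 (y ∷ t) v∈𝒜 , init∈𝒜 , v∈𝒜)) λ where
                     (inj₁ α∷v∈𝒜)              → ⊥-elim (𝒜⇒∷∉𝒜 (y ∷ t) v∈𝒜 α∷v∈𝒜)
                     (inj₂ (_ , init∈𝒜 , _)) → init∈𝒜)
         (∃!-𝒜-∷ (initV (y ∷ t)) (𝒜⇒initV∉𝒜 (y ∷ t) v∈𝒜))

  ∃!-ℳ-∷ʳ : ∀ n (u : Vec K n) → ∃! _≡_ (λ β → ℳ F n (u ∷ʳ β))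
  ∃!-ℳ-∷ʳ n u with 𝒜? F u
  ... | no u∉𝒜 = ∃!-⇔ (λ β → mk⇔ inj₁ λ where
                                  (inj₁ u∷ʳβ∈𝒜)           → u∷ʳβ∈𝒜
                                  (inj₂ (_ , init∈𝒜 , _)) → ⊥-elim (u∉𝒜 (subst (𝒜 F) (initV-∷ʳ u β) init∈𝒜)))
                      (∃!-𝒜-∷ʳ u u∉𝒜)
  ∃!-ℳ-∷ʳ zero    []      | yes []∈𝒜 = ⊥-elim ([]∉𝒜 []∈𝒜)
  ∃!-ℳ-∷ʳ (suc n) (y ∷ t) | yes u∈𝒜  =
    ∃!-⇔ (λ β → mk⇔ (λ t∷ʳβ∈𝒜 → inj₂ (𝒜⇒∷ʳ∉𝒜 (y ∷ t) u∈𝒜 , init∈𝒜 β , t∷ʳβ∈𝒜)) λ where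
                     (inj₁ u∷ʳβ∈𝒜)           → ⊥-elim (𝒜⇒∷ʳ∉𝒜 (y ∷ t) u∈𝒜 u∷ʳβ∈𝒜)
                     (inj₂ (_ , _ , t∷ʳβ∈𝒜)) → t∷ʳβ∈𝒜)
         (∃!-𝒜-∷ʳ t (λ t∈𝒜 → 𝒜⇒∷∉𝒜 t t∈𝒜 u∈𝒜))
    where
    init∈𝒜 : ∀ β → 𝒜 F (initV ((y ∷ t) ∷ʳ β))
    init∈𝒜 β = subst (𝒜 F) (sym (initV-∷ʳ (y ∷ t) β)) u∈𝒜

theorem2p15 : (F : FiniteField) (n : ℕ) →
    MockParityCheckSet (FiniteField.enum F) n (ℳ F n) (ℳ? F n)
theorem2p15 F n = record
  { uniqueSucc  = λ w _ → unique-successor (∃!-ℳ-∷ʳ F n) w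
  ; uniquePred  = λ w _ → unique-predecessor (∃!-ℳ-∷ F n) w
  ; cardinality = card-∃!-head (FiniteField.enum F) n (ℳ? F n) (∃!-ℳ-∷ F n)
  }
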